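{- Let $G=(V,E)$ be a directed graph whose underlying graph is $d$-regular, $p$ a prime, and $\sigma:V\to\mathbb{F}_p$ with $\sum_{u\in V}\sigma(u)\not\equiv 0\pmod p$. Then $\neg\mathrm{TS}^{(p)}_{G,\sigma}$ has tree-like $\mathrm{Res}(\mathrm{lin}_{\mathbb{F}_p})$ refutations of size polynomial in the size of $\neg\mathrm{TS}^{(p)}_{G,\sigma}$.
   Context: Assign a boolean variable $x_e$ to each edge $e\in E$. $\neg\mathrm{TS}^{(p)}_{G,\sigma}$ is the CNF which, for every $u\in V$, contains the canonical CNF (one clause per falsifying assignment, no extra variables) of the boolean function of the variables of edges incident to $u$ expressing $\sum_{(u,v)\in E}x_{(u,v)}-\sum_{(v,u)\in E}x_{(v,u)}\equiv\sigma(u)\pmod p$. A CNF is viewed as a set of linear clauses by writing literal $x$ as $x=1$ and $\neg x$ as $x=0$. A linear clause over $\mathbb{F}_p$ is a disjunction of linear equations (duplicates identified). $\mathrm{Res}(\mathrm{lin}_{\mathbb{F}_p})$: boolean axioms $x=0\vee x=1$; rules resolution (from $C\vee f=0$ and $D\vee g=0$ derive $C\vee D\vee(\alpha f+\beta g=0)$, $\alpha,\beta\in\mathbb{F}_p$), simplification (from $C\vee a=0$, $a\ne0$ constant, derive $C$), weakening (from $C$ derive $C\vee f=0$). A refutation derives the empty clause; tree-like means each occurrence of a clause is used at most once as a premise; size is total number of variable occurrences plus total size of coefficients. -}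

module Defs where

open import Data.Nat using (ℕ; zero; suc; _+_; _*_; _∸_; _≤_; NonZero)
open import Data.Nat.DivMod using (_mod_)
open import Data.Nat.Logarithm using (⌈log₂_⌉)
open import Data.Fin using (Fin; toℕ) renaming (_≟_ to _≟ᶠ_)
open import Data.Vec using (Vec; tabulate; zipWith; lookup; _∷_; head; tail)
import Data.Vec.Properties as VecP
open import Data.Nat.ListAction using (sum)
open import Data.List using (List; []; _∷_; _++_; map; filter; length; deduplicate; allFin; concatMap; zip; foldr)
open import Data.List.Membership.Propositional using (_∈_)
open import Data.List.Relation.Unary.All using (All)
open import Data.Bool using (Bool; true; false; if_then_else_)
open import Data.Product using (_×_; _,_; proj₁; proj₂)
open import Data.Sum using (_⊎_)
open import Relation.Binary.PropositionalEquality using (_≡_)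
open import Relation.Nullary using (¬_; does)
open import Relation.Nullary.Decidable using (¬?; _⊎-dec_)

-- Directed graphs on vertex set Fin n with m edges; edge e goes
-- from tail e to head e.  Edge e carries boolean variable x_e (index e).

IsDigraph : {n m : ℕ} → (Fin m → Fin n) → (Fin m → Fin n) → Set
IsDigraph {n} {m} tl hd =
  (∀ e → ¬ (tl e ≡ hd e)) ×
  (∀ e e′ → tl e ≡ tl e′ → hd e ≡ hd e′ → e ≡ e′)

incident : {n m : ℕ} → (Fin m → Fin n) → (Fin m → Fin n) → Fin n → List (Fin m)
incident tl hd u = filter (λ e → (tl e ≟ᶠ u) ⊎-dec (hd e ≟ᶠ u)) (allFin _)

IsRegular : {n m : ℕ} → (Fin m → Fin n) → (Fin m → Fin n) → ℕ → Set
IsRegular tl hd d = ∀ u → length (incident tl hd u) ≡ d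

module _ (p : ℕ) .{{_ : NonZero p}} where

  fromℕₚ : ℕ → Fin p
  fromℕₚ k = k mod p

  _+ₚ_ : Fin p → Fin p → Fin p
  a +ₚ b = fromℕₚ (toℕ a + toℕ b)

  _*ₚ_ : Fin p → Fin p → Fin p
  a *ₚ b = fromℕₚ (toℕ a * toℕ b)

-- Linear forms over F_p in variables x_0..x_{m-1}: a vector of length
-- 1+m; entry 0 is the constant term, entry (1+i) the coefficient of x_i.
-- The form f stands for the linear equation  f = 0.

Form : ℕ → ℕ → Set
Form m p = Vec (Fin p) (suc m)

_≟F_ : {m p : ℕ} → (f g : Form m p) → Relation.Nullary.Dec (f ≡ g)
_≟F_ = VecP.≡-dec _≟ᶠ_

-- linear clause: disjunction of linear equations (a list read as a set)
Clause : ℕ → ℕ → Set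
Clause m p = List (Form m p)

CNF : ℕ → ℕ → Set
CNF m p = List (Clause m p)

_≋_ : {m p : ℕ} → Clause m p → Clause m p → Set
C ≋ D = (∀ f → f ∈ C → f ∈ D) × (∀ f → f ∈ D → f ∈ C)

module _ {m p : ℕ} .{{_ : NonZero p}} where

  lincomb : Fin p → Fin p → Form m p → Form m p → Form m p
  lincomb α β f g = zipWith (λ a b → _+ₚ_ p (_*ₚ_ p α a) (_*ₚ_ p β b)) f g

  -- the equation  x_i = c   written as  x_i + (p - c) = 0
  varEq : Fin m → ℕ → Form m p
  varEq i c = fromℕₚ p (p ∸ c) ∷ tabulate (λ j → if does (i ≟ᶠ j) then fromℕₚ p 1 else fromℕₚ p 0)

  NonzeroConst : Form m p → Set
  NonzeroConst f = All (λ a → toℕ a ≡ 0) (Data.Vec.toList (tail f)) × ¬ (toℕ (head f) ≡ 0)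

coeffSize : {p : ℕ} → Fin p → ℕ
coeffSize a = ⌈log₂ (suc (toℕ a)) ⌉

formSize : {m p : ℕ} → Form m p → ℕ
formSize f = coeffSize (head f) +
  sum (map (λ a → if does (toℕ a Data.Nat.≟ 0) then 0 else suc (coeffSize a))
           (Data.Vec.toList (tail f)))

clauseSize : {m p : ℕ} → Clause m p → ℕ
clauseSize C = sum (map formSize (deduplicate _≟F_ C))

cnfSize : {m p : ℕ} → CNF m p → ℕ
cnfSize F = sum (map clauseSize F)

assignments : ℕ → List (List Bool)
assignments zero = [] ∷ []
assignments (suc k) = concatMap (λ a → (false ∷ a) ∷ (true ∷ a) ∷ []) (assignments k)

module _ {n m : ℕ} (p : ℕ) .{{_ : NonZero p}}
         (tl hd : Fin m → Fin n) (σ : Fin n → Fin p) where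

  netFlow : Fin n → List (Fin m × Bool) → Fin p
  netFlow u = foldr step (fromℕₚ p 0)
    where
    step : Fin m × Bool → Fin p → Fin p
    step (e , false) acc = acc
    step (e , true)  acc =
      _+ₚ_ p acc (_+ₚ_ p (if does (tl e ≟ᶠ u) then fromℕₚ p 1 else fromℕₚ p 0)
                         (if does (hd e ≟ᶠ u) then fromℕₚ p (p ∸ 1) else fromℕₚ p 0))

  -- the clause falsified exactly by the given assignment:
  -- literal x_e (i.e. x_e = 1) if the assignment sets x_e = 0,
  -- literal ¬x_e (i.e. x_e = 0) if it sets x_e = 1
  falsifyingClause : List (Fin m × Bool) → Clause m p
  falsifyingClause = map (λ { (e , false) → varEq e 1 ; (e , true) → varEq e 0 })

  vertexCNF : Fin n → CNF m p
  vertexCNF u =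
    map falsifyingClause
      (filter (λ α → ¬? (netFlow u α ≟ᶠ σ u))
        (map (zip (incident tl hd u)) (assignments (length (incident tl hd u)))))

  TseitinCNF : CNF m p
  TseitinCNF = concatMap vertexCNF (allFin n)

-- Tree-like Res(lin_{F_p}) derivations from a CNF F.  A derivation is
-- a tree; every rule may present its conclusion as any list equal to
-- it as a set.

data Deriv {m p : ℕ} .{{_ : NonZero p}} (F : CNF m p) : Clause m p → Set where
  axiom : ∀ {C D} → C ∈ F → C ≋ D → Deriv F D
  boolean : ∀ {D} (i : Fin m) → (varEq i 0 ∷ varEq i 1 ∷ []) ≋ D → Deriv F D
  resolution : ∀ {f g C D E} (α β : Fin p) →
    Deriv F (f ∷ C) → Deriv F (g ∷ D) → (lincomb α β f g ∷ (C ++ D)) ≋ E → Deriv F E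
  simplification : ∀ {a C D} → NonzeroConst a → Deriv F (a ∷ C) → C ≋ D → Deriv F D
  weakening : ∀ {f C D} → Deriv F C → (f ∷ C) ≋ D → Deriv F D

derivSize : {m p : ℕ} .{{_ : NonZero p}} {F : CNF m p} {C : Clause m p} → Deriv F C → ℕ
derivSize {C = C} (axiom _ _) = clauseSize C
derivSize {C = C} (boolean _ _) = clauseSize C
derivSize {C = C} (resolution _ _ π ρ _) = clauseSize C + derivSize π + derivSize ρ
derivSize {C = C} (simplification _ π _) = clauseSize C + derivSize π
derivSize {C = C} (weakening π _) = clauseSize C + derivSize π

Refutation : {m p : ℕ} .{{_ : NonZero p}} → CNF m p → Set
Refutation F = Deriv F []

module Submission where

-- Let L_u be the equation Σ_e coef(u,e)·x_e − σ(u) = 0 of the constraint at u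
-- (coef = 1 at the tail of e, −1 at its head).  Each L_u is derived by
-- splitting on the d edges at u: a split resolves x_e = 1 ∨ Γ with x_e = 0 ∨ Γ
-- (coefficients 1, −1) and simplifies the constant −1 away; at a leaf the
-- assignment either violates the constraint (its clause is an axiom, weakened
-- by L_u) or satisfies it, and then L_u = Σ_e coef(u,e)·(x_e − b_e) is a chain
-- of resolutions of boolean axioms.  Summing all L_u cancels every variable and
-- leaves the constant −Σ_u σ(u) ≠ 0, which simplifies to the empty clause.
-- All clauses have at most d + 2 formulas, while the formula has size at least
-- n·2^(d−1) (of two assignments differing at one edge, one is violating) and at
-- least ⌈log₂ p⌉, and m ≤ n²; this gives the bound 288·|F|^6 (d = 0 is trivial).

open import Defs
open import Level using (0ℓ)
open import Function using (_∘_)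
open import Data.Empty using (⊥-elim)
open import Data.Bool using (Bool; true; false; if_then_else_)
open import Data.Product using (Σ; ∃; ∃-syntax; _×_; _,_; proj₁; proj₂)
open import Data.Sum using (_⊎_; inj₁; inj₂; [_,_]′)
open import Data.Nat using (ℕ; zero; suc; _+_; _*_; _∸_; _^_; _⊓_; _≤_; NonZero; >-nonZero⁻¹; z≤n; s≤s; _%_)
open import Data.Nat.Properties
open import Data.Nat.DivMod using (m%n<n; m%n%n≡m%n; n%n≡0; %-distribˡ-+; %-distribˡ-*; m<n⇒m%n≡m)
open import Data.Nat.Divisibility using (_∣_; m%n≡0⇒n∣m; _∣0)
open import Data.Nat.Primality using (Prime; ¬prime[0]; ¬prime[1])
open import Data.Nat.Logarithm using (⌈log₂_⌉; ⌈log₂⌉-mono-≤)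
open import Data.Nat.ListAction using (sum)
open import Data.Nat.ListAction.Properties using (sum-++)
open import Data.Nat.Tactic.RingSolver using (solve-∀)
open import Algebra.Properties.CommutativeSemigroup +-commutativeSemigroup using (interchange)
open import Data.Fin using (Fin; toℕ) renaming (zero to fz; suc to fs; _≟_ to _≟ᶠ_)
import Data.Fin.Properties as FinP
open import Data.Vec using (Vec; []; _∷_; lookup; tabulate; toList)
import Data.Vec.Properties as VecP
import Data.Vec.Membership.Propositional.Properties as VecMem
open import Data.List using (List; []; _∷_; _++_; map; filter; length; allFin; zip; deduplicate; concatMap; replicate)
import Data.List.Properties as LP
open import Data.List.Membership.Propositional using (_∈_)
open import Data.List.Membership.Propositional.Properties
open import Data.List.Relation.Unary.Any using (here; there)
import Data.List.Relation.Unary.Any as Any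
open import Data.List.Relation.Unary.All using (All) renaming ([] to []ᴬ; _∷_ to _∷ᴬ_)
open import Relation.Nullary using (¬_; Dec; does; yes; no)
open import Relation.Nullary.Decidable using (¬?; _⊎-dec_)
open import Relation.Unary using (Decidable)
open import Relation.Binary.Structures using (IsEquivalence)
open import Relation.Binary.Bundles using (Setoid)
import Relation.Binary.Reasoning.Setoid as SetoidReasoning
open import Relation.Binary.PropositionalEquality

∑ : {A : Set} → List A → (A → ℕ) → ℕ
∑ xs f = sum (map f xs)

∑-cong : {A : Set} (xs : List A) {f g : A → ℕ} → (∀ x → f x ≡ g x) → ∑ xs f ≡ ∑ xs g
∑-cong [] h = refl
∑-cong (x ∷ xs) h = cong₂ _+_ (h x) (∑-cong xs h)

∑-+ : {A : Set} (xs : List A) (f g : A → ℕ) → ∑ xs f + ∑ xs g ≡ ∑ xs (λ x → f x + g x)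
∑-+ [] f g = refl
∑-+ (x ∷ xs) f g = trans (interchange (f x) (∑ xs f) (g x) (∑ xs g)) (cong (f x + g x +_) (∑-+ xs f g))

∑-zero : {A : Set} (xs : List A) {f : A → ℕ} → (∀ x → f x ≡ 0) → ∑ xs f ≡ 0
∑-zero [] h = refl
∑-zero (x ∷ xs) h rewrite h x = ∑-zero xs h

∑-tabulate : {N : ℕ} {A : Set} (g : Fin N → A) (f : A → ℕ) →
  ∑ (Data.List.tabulate g) f ≡ ∑ (allFin N) (λ x → f (g x))
∑-tabulate g f = trans (cong sum (LP.map-tabulate g f)) (sym (cong sum (LP.map-tabulate (λ x → x) (λ x → f (g x)))))

∑-zip : {A B : Set} (xs : List A) (ys : List B) (g : A → ℕ) → length ys ≡ length xs →
  ∑ (zip xs ys) (λ x → g (proj₁ x)) ≡ ∑ xs g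
∑-zip [] [] g _ = refl
∑-zip (x ∷ xs) (y ∷ ys) g h = cong (g x +_) (∑-zip xs ys g (suc-injective h))

∑-≤ : {A : Set} (xs : List A) {f : A → ℕ} {c : ℕ} → (∀ x → f x ≤ c) → ∑ xs f ≤ length xs * c
∑-≤ [] h = z≤n
∑-≤ (x ∷ xs) h = +-mono-≤ (h x) (∑-≤ xs h)

∑-≥ : {A : Set} (xs : List A) {f : A → ℕ} {c : ℕ} → (∀ x → c ≤ f x) → length xs * c ≤ ∑ xs f
∑-≥ [] h = z≤n
∑-≥ (x ∷ xs) h = +-mono-≤ (h x) (∑-≥ xs h)

∈-∑ : {A : Set} {x : A} {xs : List A} (f : A → ℕ) → x ∈ xs → f x ≤ ∑ xs f
∈-∑ {xs = y ∷ xs} f (here refl) = m≤m+n (f y) (∑ xs f)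
∈-∑ {xs = y ∷ xs} f (there x∈) = ≤-trans (∈-∑ f x∈) (m≤n+m (∑ xs f) (f y))

δ : {N : ℕ} → Fin N → Fin N → ℕ
δ a b = if does (a ≟ᶠ b) then 1 else 0

δ-sym : {N : ℕ} (a b : Fin N) → δ a b ≡ δ b a
δ-sym a b with a ≟ᶠ b | b ≟ᶠ a
... | yes _  | yes _  = refl
... | no _   | no _   = refl
... | yes eq | no neq = ⊥-elim (neq (sym eq))
... | no neq | yes eq = ⊥-elim (neq (sym eq))

δ-yes : {N : ℕ} {a b : Fin N} → a ≡ b → δ a b ≡ 1
δ-yes {a = a} {b} a≡b with a ≟ᶠ b
... | yes _ = refl
... | no a≢b = ⊥-elim (a≢b a≡b)

δ-no : {N : ℕ} {a b : Fin N} → ¬ (a ≡ b) → δ a b ≡ 0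
δ-no {a = a} {b} a≢b with a ≟ᶠ b
... | yes a≡b = ⊥-elim (a≢b a≡b)
... | no _ = refl

∑-δ : {N : ℕ} (a : Fin N) (g : Fin N → ℕ) → ∑ (allFin N) (λ x → δ a x * g x) ≡ g a
∑-δ {suc N} fz g = trans
  (cong₂ _+_ (+-identityʳ (g fz)) (trans (∑-tabulate fs (λ x → δ fz x * g x)) (∑-zero (allFin N) (λ _ → refl))))
  (+-identityʳ (g fz))
∑-δ {suc N} (fs a) g = trans (∑-tabulate fs (λ x → δ (fs a) x * g x)) (∑-δ a (λ x → g (fs x)))

nonzero-summand : {A : Set} (xs : List A) (f : A → ℕ) → ¬ (∑ xs f ≡ 0) → Σ A λ x → ¬ (f x ≡ 0)
nonzero-summand [] f Σ≢0 = ⊥-elim (Σ≢0 refl)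
nonzero-summand (x ∷ xs) f Σ≢0 with f x Data.Nat.≟ 0
... | no fx≢0 = x , fx≢0
... | yes fx≡0 = nonzero-summand xs f (λ Σxs≡0 → Σ≢0 (cong₂ _+_ fx≡0 Σxs≡0))

allFin-∷ : {N : ℕ} → Fin N → Σ (Fin N) λ u → Σ (List (Fin N)) λ us → allFin N ≡ u ∷ us
allFin-∷ {suc N} _ = fz , Data.List.tabulate fs , refl

length-zip : {A B : Set} (xs : List A) (ys : List B) → length ys ≡ length xs → length (zip xs ys) ≡ length xs
length-zip xs ys len = trans (LP.length-zipWith _,_ xs ys) (trans (cong (length xs ⊓_) len) (⊓-idem (length xs)))

concatMap-[] : {A B : Set} (xs : List A) → concatMap (λ _ → [] {A = B}) xs ≡ []
concatMap-[] [] = refl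
concatMap-[] (x ∷ xs) = concatMap-[] xs

-- Arithmetic of F_p on representatives: congruence of natural numbers mod p.
module Congruence (p : ℕ) .{{_ : NonZero p}} where

  infix 4 _≈_
  -- a record, so that both sides can be inferred from a proof
  record _≈_ (a b : ℕ) : Set where
    constructor ≈i
    field un : a % p ≡ b % p
  open _≈_ public

  ≈-isEquivalence : IsEquivalence _≈_
  ≈-isEquivalence = record
    { refl  = ≈i refl
    ; sym   = λ { (≈i h) → ≈i (sym h) }
    ; trans = λ { (≈i h) (≈i g) → ≈i (trans h g) }
    }

  ≈-setoid : Setoid 0ℓ 0ℓ
  ≈-setoid = record { isEquivalence = ≈-isEquivalence }

  open IsEquivalence ≈-isEquivalence public
    using () renaming (refl to ≈-refl; sym to ≈-sym; trans to ≈-trans)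

  ≡⇒≈ : ∀ {a b} → a ≡ b → a ≈ b
  ≡⇒≈ refl = ≈-refl

  +-≈ : ∀ {a b c e} → a ≈ b → c ≈ e → a + c ≈ b + e
  +-≈ {a} {b} {c} {e} (≈i h₁) (≈i h₂) = ≈i (begin
    (a + c) % p             ≡⟨ %-distribˡ-+ a c p ⟩
    (a % p + c % p) % p     ≡⟨ cong₂ (λ x y → (x + y) % p) h₁ h₂ ⟩
    (b % p + e % p) % p     ≡⟨ %-distribˡ-+ b e p ⟨
    (b + e) % p             ∎)
    where open ≡-Reasoning

  *-≈ : ∀ {a b c e} → a ≈ b → c ≈ e → a * c ≈ b * e
  *-≈ {a} {b} {c} {e} (≈i h₁) (≈i h₂) = ≈i (begin
    (a * c) % p             ≡⟨ %-distribˡ-* a c p ⟩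
    (a % p * (c % p)) % p   ≡⟨ cong₂ (λ x y → (x * y) % p) h₁ h₂ ⟩
    (b % p * (e % p)) % p   ≡⟨ %-distribˡ-* b e p ⟨
    (b * e) % p             ∎)
    where open ≡-Reasoning

  %≈ : ∀ a → a % p ≈ a
  %≈ a = ≈i (m%n%n≡m%n a p)

  0%p≡0 : 0 % p ≡ 0
  0%p≡0 = m<n⇒m%n≡m (>-nonZero⁻¹ p)

  p≈0 : p ≈ 0
  p≈0 = ≈i (trans (n%n≡0 p) (sym 0%p≡0))

  ∸-inverse : ∀ {a} → a ≤ p → p ∸ a + a ≈ 0
  ∸-inverse a≤p = ≈-trans (≡⇒≈ (m∸n+n≡m a≤p)) p≈0

  -- addition is cancellative (every a has the inverse p ∸ a % p)
  +-cancelˡ-≈ : ∀ a {b c} → a + b ≈ a + c → b ≈ c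
  +-cancelˡ-≈ a {b} {c} h = begin
    b              ≈⟨ +-≈ inverse ≈-refl ⟨
    ā + a + b      ≡⟨ +-assoc ā a b ⟩
    ā + (a + b)    ≈⟨ +-≈ (≈-refl {ā}) h ⟩
    ā + (a + c)    ≡⟨ +-assoc ā a c ⟨
    ā + a + c      ≈⟨ +-≈ inverse ≈-refl ⟩
    c              ∎
    where
    open SetoidReasoning ≈-setoid
    ā : ℕ
    ā = p ∸ a % p
    inverse : ā + a ≈ 0
    inverse = ≈-trans (+-≈ (≈-refl {ā}) (≈-sym (%≈ a))) (∸-inverse (<⇒≤ (m%n<n a p)))

  inverse-unique : ∀ {a b c} → a + b ≈ 0 → c + b ≈ 0 → a ≈ c
  inverse-unique {a} {b} {c} h₁ h₂ = +-cancelˡ-≈ b (begin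
    b + a   ≡⟨ +-comm b a ⟩
    a + b   ≈⟨ h₁ ⟩
    0       ≈⟨ h₂ ⟨
    c + b   ≡⟨ +-comm c b ⟩
    b + c   ∎)
    where open SetoidReasoning ≈-setoid

  ∑-≈ : {A : Set} (xs : List A) {f g : A → ℕ} → (∀ x → f x ≈ g x) → ∑ xs f ≈ ∑ xs g
  ∑-≈ [] h = ≈-refl
  ∑-≈ (x ∷ xs) h = +-≈ (h x) (∑-≈ xs h)

  ∑-filter : {A : Set} {P : A → Set} (P? : Decidable P) (xs : List A) {g : A → ℕ} →
    (∀ x → ¬ P x → g x ≈ 0) → ∑ (filter P? xs) g ≈ ∑ xs g
  ∑-filter P? [] h = ≈-refl
  ∑-filter P? (x ∷ xs) {g} h with P? x
  ... | yes _ = +-≈ (≈-refl {g x}) (∑-filter P? xs h)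
  ... | no ¬Px = +-≈ (≈-sym (h x ¬Px)) (∑-filter P? xs h)

  toℕ-% : (x : Fin p) → toℕ x % p ≡ toℕ x
  toℕ-% x = m<n⇒m%n≡m (FinP.toℕ<n x)

  fin-≈ : {x y : Fin p} → toℕ x ≈ toℕ y → x ≡ y
  fin-≈ {x} {y} (≈i h) = FinP.toℕ-injective (trans (sym (toℕ-% x)) (trans h (toℕ-% y)))

  toℕ-fromℕₚ≈ : ∀ k → toℕ (fromℕₚ p k) ≈ k
  toℕ-fromℕₚ≈ k = ≈-trans (≡⇒≈ (FinP.toℕ-fromℕ< _)) (%≈ k)

  +ₚ-cancel : (a c : Fin p) → _+ₚ_ p a c ≡ a → toℕ c ≈ 0
  +ₚ-cancel a c h = +-cancelˡ-≈ (toℕ a) (begin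
    toℕ a + toℕ c            ≈⟨ toℕ-fromℕₚ≈ (toℕ a + toℕ c) ⟨
    toℕ (_+ₚ_ p a c)         ≡⟨ cong toℕ h ⟩
    toℕ a                    ≡⟨ +-identityʳ (toℕ a) ⟨
    toℕ a + 0                ∎)
    where open SetoidReasoning ≈-setoid

  one-* : ∀ x → toℕ (fromℕₚ p 1) * x ≈ x
  one-* x = ≈-trans (*-≈ (toℕ-fromℕₚ≈ 1) (≈-refl {x})) (≡⇒≈ (*-identityˡ x))

  toℕ-if : (b : Bool) (c : ℕ) → toℕ (if b then fromℕₚ p c else fromℕₚ p 0) ≈ (if b then c else 0)
  toℕ-if true c = toℕ-fromℕₚ≈ c
  toℕ-if false c = toℕ-fromℕₚ≈ 0

  -- A form f is represented by φ when its i-th entry is φ i modulo p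
  -- (entry 0 is the constant term); this lets us compute with forms in ℕ.
  Rep : {m : ℕ} → Form m p → (Fin (suc m) → ℕ) → Set
  Rep f φ = ∀ i → toℕ (lookup f i) ≈ φ i

  Rep-ext : {m : ℕ} {f g : Form m p} {φ ψ : Fin (suc m) → ℕ} →
    Rep f φ → Rep g ψ → (∀ i → φ i ≈ ψ i) → f ≡ g
  Rep-ext {f = f} {g} hf hg h = begin
    f                        ≡⟨ VecP.tabulate∘lookup f ⟨
    tabulate (lookup f)      ≡⟨ VecP.tabulate-cong (λ i → fin-≈ (≈-trans (hf i) (≈-trans (h i) (≈-sym (hg i))))) ⟩
    tabulate (lookup g)      ≡⟨ VecP.tabulate∘lookup g ⟩
    g                        ∎
    where open ≡-Reasoning

  Rep-cong : {m : ℕ} {f : Form m p} {φ ψ : Fin (suc m) → ℕ} → Rep f φ → (∀ i → φ i ≈ ψ i) → Rep f ψ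
  Rep-cong hf h i = ≈-trans (hf i) (h i)

  lincomb-Rep : {m : ℕ} (α β : Fin p) {f g : Form m p} {φ ψ : Fin (suc m) → ℕ} → Rep f φ → Rep g ψ →
    Rep (lincomb α β f g) (λ i → toℕ α * φ i + toℕ β * ψ i)
  lincomb-Rep α β {f} {g} {φ} {ψ} hf hg i = begin
    toℕ (lookup (lincomb α β f g) i)                       ≡⟨ cong toℕ (VecP.lookup-zipWith _ i f g) ⟩
    toℕ (_+ₚ_ p (_*ₚ_ p α (lookup f i)) (_*ₚ_ p β (lookup g i)))
      ≈⟨ toℕ-fromℕₚ≈ _ ⟩
    toℕ (_*ₚ_ p α (lookup f i)) + toℕ (_*ₚ_ p β (lookup g i))
      ≈⟨ +-≈ (toℕ-fromℕₚ≈ _) (toℕ-fromℕₚ≈ _) ⟩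
    toℕ α * toℕ (lookup f i) + toℕ β * toℕ (lookup g i)    ≈⟨ +-≈ (*-≈ (≈-refl {toℕ α}) (hf i)) (*-≈ (≈-refl {toℕ β}) (hg i)) ⟩
    toℕ α * φ i + toℕ β * ψ i                              ∎
    where open SetoidReasoning ≈-setoid

  varEqSem : {m : ℕ} → Fin m → ℕ → Fin (suc m) → ℕ
  varEqSem e c fz = p ∸ c
  varEqSem e c (fs j) = δ e j

  varEq-Rep : {m : ℕ} (e : Fin m) (c : ℕ) → Rep (varEq e c) (varEqSem e c)
  varEq-Rep e c fz = toℕ-fromℕₚ≈ (p ∸ c)
  varEq-Rep e c (fs j) = ≈-trans
    (≡⇒≈ (cong toℕ (VecP.lookup∘tabulate (λ j → if does (e ≟ᶠ j) then fromℕₚ p 1 else fromℕₚ p 0) j)))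
    (toℕ-if (does (e ≟ᶠ j)) 1)

  nonzero-Rep : {m : ℕ} {f : Form m p} {φ : Fin (suc m) → ℕ} → Rep f φ →
    ¬ (φ fz ≈ 0) → (∀ j → φ (fs j) ≈ 0) → NonzeroConst f
  nonzero-Rep {f = c ∷ v} hf h₀ hⱼ = vanishing v (λ j → ≈-trans (hf (fs j)) (hⱼ j)) ,
                                     λ c≡0 → h₀ (≈-trans (≈-sym (hf fz)) (≡⇒≈ c≡0))
    where
    vanishing : ∀ {k} (v : Vec (Fin p) k) → (∀ j → toℕ (lookup v j) ≈ 0) → All (λ a → toℕ a ≡ 0) (toList v)
    vanishing [] h = []ᴬ
    vanishing (a ∷ v) h = trans (sym (toℕ-% a)) (trans (un (h fz)) 0%p≡0) ∷ᴬ vanishing v (λ j → h (fs j))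

  -- The linear combination Σ_{b ∈ a ∷ as} α b · f b, in the shape produced
  -- by a chain of resolution steps (the last form is combined with itself
  -- and coefficient 0).
  combo : {A : Set} {m : ℕ} → (A → Fin p) → (A → Form m p) → A → List A → Form m p
  combo α f a [] = lincomb (α a) (fromℕₚ p 0) (f a) (f a)
  combo α f a (b ∷ bs) = lincomb (α a) (fromℕₚ p 1) (f a) (combo α f b bs)

  combo-Rep : {A : Set} {m : ℕ} (α : A → Fin p) {f : A → Form m p} {φ : A → Fin (suc m) → ℕ} →
    (∀ a → Rep (f a) (φ a)) → ∀ a as → Rep (combo α f a as) (λ i → ∑ (a ∷ as) (λ b → toℕ (α b) * φ b i))
  combo-Rep α {f} {φ} hf a [] = Rep-cong {f = combo α f a []} (lincomb-Rep (α a) (fromℕₚ p 0) {f a} {f a} (hf a) (hf a))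
    (λ i → +-≈ (≈-refl {toℕ (α a) * φ a i}) (*-≈ (toℕ-fromℕₚ≈ 0) (≈-refl {φ a i})))
  combo-Rep α {f} {φ} hf a (b ∷ bs) = Rep-cong {f = combo α f a (b ∷ bs)} (lincomb-Rep (α a) (fromℕₚ p 1) {f a} {combo α f b bs} (hf a) (combo-Rep α hf b bs))
    (λ i → +-≈ (≈-refl {toℕ (α a) * φ a i})
                (≈-trans (*-≈ (toℕ-fromℕₚ≈ 1) (≈-refl {∑ (b ∷ bs) (λ c → toℕ (α c) * φ c i)})) (≡⇒≈ (*-identityˡ _))))

module ClauseEquality {m p : ℕ} where

  ≋-refl : {C : Clause m p} → C ≋ C
  ≋-refl = (λ _ x → x) , (λ _ x → x)

  ≋-trans : {C D E : Clause m p} → C ≋ D → D ≋ E → C ≋ E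
  ≋-trans (to₁ , from₁) (to₂ , from₂) = (λ f x → to₂ f (to₁ f x)) , (λ f x → from₁ f (from₂ f x))

  ≡⇒≋ : {C D : Clause m p} → C ≡ D → C ≋ D
  ≡⇒≋ refl = ≋-refl

  ∷-cong : (f : Form m p) {C D : Clause m p} → C ≋ D → (f ∷ C) ≋ (f ∷ D)
  ∷-cong f (to , from) = (λ { g (here eq) → here eq ; g (there x) → there (to g x) })
                       , (λ { g (here eq) → here eq ; g (there x) → there (from g x) })

  ∷-swap : (f g : Form m p) (C : Clause m p) → (f ∷ g ∷ C) ≋ (g ∷ f ∷ C)
  ∷-swap f g C = swap , swap
    where
    swap : ∀ {f g : Form m p} h → h ∈ f ∷ g ∷ C → h ∈ g ∷ f ∷ C
    swap h (here eq) = there (here eq)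
    swap h (there (here eq)) = here eq
    swap h (there (there x)) = there (there x)

  ++-idem : (C : Clause m p) → (C ++ C) ≋ C
  ++-idem C = (λ f x → [ (λ y → y) , (λ y → y) ]′ (∈-++⁻ C x)) , (λ f x → ∈-++⁺ˡ x)

  ∷-++ : (f : Form m p) (A B : Clause m p) → ((f ∷ A) ++ B) ≋ (A ++ (f ∷ B))
  ∷-++ f A B = to , from
    where
    to : ∀ g → g ∈ (f ∷ A) ++ B → g ∈ A ++ (f ∷ B)
    to g (here eq) = ∈-++⁺ʳ A (here eq)
    to g (there x) with ∈-++⁻ A x
    ... | inj₁ y = ∈-++⁺ˡ y
    ... | inj₂ y = ∈-++⁺ʳ A (there y)
    from : ∀ g → g ∈ A ++ (f ∷ B) → g ∈ (f ∷ A) ++ B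
    from g x with ∈-++⁻ A x
    ... | inj₁ y = there (∈-++⁺ˡ y)
    ... | inj₂ (here eq) = here eq
    ... | inj₂ (there y) = there (∈-++⁺ʳ A y)

  ∷-snoc : (f : Form m p) (A : Clause m p) → (f ∷ A) ≋ (A ++ (f ∷ []))
  ∷-snoc f A = ≋-trans (≡⇒≋ (sym (LP.++-identityʳ (f ∷ A)))) (∷-++ f A [])

formBound : ℕ → ℕ → ℕ
formBound m p = suc m * suc ⌈log₂ p ⌉

entrySize : {p : ℕ} → Fin p → ℕ
entrySize a = if does (toℕ a Data.Nat.≟ 0) then 0 else suc (coeffSize a)

coeffSize-≤ : {p : ℕ} (a : Fin p) → coeffSize a ≤ ⌈log₂ p ⌉
coeffSize-≤ a = ⌈log₂⌉-mono-≤ (FinP.toℕ<n a)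

entrySize-≤ : {p : ℕ} (a : Fin p) → entrySize a ≤ suc ⌈log₂ p ⌉
entrySize-≤ a with does (toℕ a Data.Nat.≟ 0)
... | true = z≤n
... | false = s≤s (coeffSize-≤ a)

formSize-≤ : {m p : ℕ} (f : Form m p) → formSize f ≤ formBound m p
formSize-≤ {p = p} (a ∷ v) = +-mono-≤ (≤-trans (coeffSize-≤ a) (n≤1+n _))
  (≤-trans (∑-≤ (toList v) entrySize-≤) (≤-reflexive (cong (_* suc ⌈log₂ p ⌉) (VecP.length-toList v))))

clauseSize-≤ : {m p : ℕ} (C : Clause m p) → clauseSize C ≤ length C * formBound m p
clauseSize-≤ {m} {p} C = ≤-trans (∑-≤ (deduplicate _≟F_ C) formSize-≤)
  (*-monoˡ-≤ (formBound m p) (LP.length-deduplicate _≟F_ C))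

clauseSize-≥ : {m p : ℕ} {f : Form m p} {C : Clause m p} → f ∈ C → formSize f ≤ clauseSize C
clauseSize-≥ f∈C = ∈-∑ formSize (∈-deduplicate⁺ _≟F_ f∈C)

cnfSize-≥ : {m p : ℕ} {C : Clause m p} {F : CNF m p} → C ∈ F → clauseSize C ≤ cnfSize F
cnfSize-≥ C∈F = ∈-∑ clauseSize C∈F

cnfSize-concatMap : {A : Set} {m p : ℕ} (G : A → CNF m p) (xs : List A) →
  cnfSize (concatMap G xs) ≡ ∑ xs (λ x → cnfSize (G x))
cnfSize-concatMap G [] = refl
cnfSize-concatMap G (x ∷ xs) = begin
  sum (map clauseSize (G x ++ concatMap G xs))              ≡⟨ cong sum (LP.map-++ clauseSize (G x) _) ⟩
  sum (map clauseSize (G x) ++ map clauseSize (concatMap G xs)) ≡⟨ sum-++ (map clauseSize (G x)) _ ⟩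
  cnfSize (G x) + cnfSize (concatMap G xs)                  ≡⟨ cong (cnfSize (G x) +_) (cnfSize-concatMap G xs) ⟩
  cnfSize (G x) + ∑ xs (λ x → cnfSize (G x))                ∎
  where open ≡-Reasoning

-- Tree-like derivations from F all of whose clauses have at most K
-- formulas, counted by their number of nodes N: such a derivation has
-- size at most N · S.  "Derivable C N" asks for this in every
-- presentation of C as a list of at most K formulas, so that clause
-- reorderings cost nothing.
module BoundedDerivations {m p : ℕ} .{{_ : NonZero p}} (F : CNF m p) (K : ℕ) where
  open ClauseEquality
  open Congruence p using (combo)

  S : ℕ
  S = K * formBound m p

  node-≤ : (D : Clause m p) → length D ≤ K → clauseSize D ≤ S
  node-≤ D len = ≤-trans (clauseSize-≤ D) (*-monoˡ-≤ (formBound m p) len)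

  record Derivable (C : Clause m p) (N : ℕ) : Set where
    constructor derivable
    field derive : ∀ D → C ≋ D → length D ≤ K → Σ (Deriv F D) (λ π → derivSize π ≤ N * S)
  open Derivable

  Derivable-≋ : ∀ {C C′ N} → C ≋ C′ → Derivable C N → Derivable C′ N
  Derivable-≋ eq π = derivable λ D eq′ len → derive π D (≋-trans eq eq′) len

  Derivable-mono : ∀ {C N N′} → N ≤ N′ → Derivable C N → Derivable C N′
  Derivable-mono N≤N′ π = derivable λ D eq len →
    proj₁ (derive π D eq len) , ≤-trans (proj₂ (derive π D eq len)) (*-monoˡ-≤ S N≤N′)

  axiomᴰ : ∀ {C} → C ∈ F → Derivable C 1
  axiomᴰ C∈F = derivable λ D eq len →
    axiom C∈F eq , ≤-trans (node-≤ D len) (≤-reflexive (sym (*-identityˡ S)))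

  booleanᴰ : (i : Fin m) → Derivable (varEq i 0 ∷ varEq i 1 ∷ []) 1
  booleanᴰ i = derivable λ D eq len →
    boolean i eq , ≤-trans (node-≤ D len) (≤-reflexive (sym (*-identityˡ S)))

  resolutionᴰ : ∀ {f g C D N₁ N₂} (α β : Fin p) → Derivable (f ∷ C) N₁ → Derivable (g ∷ D) N₂ →
    length (f ∷ C) ≤ K → length (g ∷ D) ≤ K → Derivable (lincomb α β f g ∷ C ++ D) (1 + N₁ + N₂)
  resolutionᴰ {N₁ = N₁} {N₂} α β π₁ π₂ len₁ len₂ = derivable λ E eq len →
    resolution α β (proj₁ left) (proj₁ right) eq ,
    ≤-trans (+-mono-≤ (+-mono-≤ (node-≤ E len) (proj₂ left)) (proj₂ right)) (≤-reflexive (count S N₁ N₂))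
    where
    left = derive π₁ _ ≋-refl len₁
    right = derive π₂ _ ≋-refl len₂
    count : ∀ S N₁ N₂ → S + N₁ * S + N₂ * S ≡ (1 + N₁ + N₂) * S
    count = solve-∀

  simplificationᴰ : ∀ {a C N} → NonzeroConst a → Derivable (a ∷ C) N → length (a ∷ C) ≤ K →
    Derivable C (1 + N)
  simplificationᴰ nz π len = derivable λ D eq lenD →
    let premise = derive π _ ≋-refl len in
    simplification nz (proj₁ premise) eq , +-mono-≤ (node-≤ D lenD) (proj₂ premise)

  weakeningᴰ : ∀ {f C N} → Derivable C N → length C ≤ K → Derivable (f ∷ C) (1 + N)
  weakeningᴰ π len = derivable λ D eq lenD →
    let premise = derive π _ ≋-refl len in
    weakening (proj₁ premise) eq , +-mono-≤ (node-≤ D lenD) (proj₂ premise)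

  refutationᴰ : ∀ {N} → Derivable [] N → Σ (Refutation F) (λ π → derivSize π ≤ N * S)
  refutationᴰ π = derive π [] ≋-refl z≤n

  combine : {A : Set} (α : A → Fin p) (g : A → Form m p) (C : A → Clause m p) {N : ℕ} →
    (∀ a → Derivable (g a ∷ C a) N) → ∀ a as → suc (length (concatMap C (a ∷ as))) ≤ K →
    Derivable (combo α g a as ∷ concatMap C (a ∷ as)) ((2 + length as) * suc N)
  combine α g C {N} π a [] len =
    Derivable-mono count (Derivable-≋ (∷-cong _ (≋-trans (++-idem (C a)) (≡⇒≋ (sym (LP.++-identityʳ (C a))))))
        (resolutionᴰ (α a) (fromℕₚ p 0) (π a) (π a) lenₐ lenₐ))
    where
    lenₐ : suc (length (C a)) ≤ K
    lenₐ = ≤-trans (≤-reflexive (cong suc (sym (cong length (LP.++-identityʳ (C a)))))) len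
    count : 1 + N + N ≤ 2 * suc N
    count = s≤s (+-monoʳ-≤ N (≤-trans (n≤1+n N) (≤-reflexive (sym (+-identityʳ (suc N))))))
  combine α g C {N} π a (b ∷ bs) len =
    resolutionᴰ (α a) (fromℕₚ p 1) (π a) (combine α g C {N} π b bs lenᵣ) lenₐ lenᵣ
    where
    lenₐ : suc (length (C a)) ≤ K
    lenₐ = ≤-trans (s≤s (LP.length-++-≤ˡ (C a))) len
    lenᵣ : suc (length (concatMap C (b ∷ bs))) ≤ K
    lenᵣ = ≤-trans (s≤s (LP.length-++-≤ʳ (concatMap C (b ∷ bs)) {C a})) len

assignments-complete : (bits : List Bool) → bits ∈ assignments (length bits)
assignments-complete [] = here refl
assignments-complete (b ∷ bits) = ∈-concatMap⁺ (λ a → (false ∷ a) ∷ (true ∷ a) ∷ []) (Any.map (λ { refl → choose b }) (assignments-complete bits))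
  where
  choose : ∀ b → (b ∷ bits) ∈ ((false ∷ bits) ∷ (true ∷ bits) ∷ [])
  choose false = here refl
  choose true = there (here refl)

length-assignments : ∀ k → length (assignments k) ≡ 2 ^ k
length-assignments zero = refl
length-assignments (suc k) = trans (doubles (assignments k)) (cong (2 *_) (length-assignments k))
  where
  doubles : (A : List (List Bool)) → length (concatMap (λ a → (false ∷ a) ∷ (true ∷ a) ∷ []) A) ≡ 2 * length A
  doubles [] = refl
  doubles (a ∷ A) = trans (cong (λ x → suc (suc x)) (doubles A)) (sym (*-suc 2 (length A)))

module Tseitin {n m : ℕ} (tl hd : Fin m → Fin n) (q : ℕ) (σ : Fin n → Fin (suc (suc q))) where

  p : ℕ
  p = suc (suc q)
  open Congruence p

  F : CNF m p
  F = TseitinCNF p tl hd σ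

  inc : Fin n → List (Fin m)
  inc = incident tl hd

  flow : Fin n → List (Fin m × Bool) → Fin p
  flow = netFlow p tl hd σ

  clauseOf : List (Fin m × Bool) → Clause m p
  clauseOf = falsifyingClause p tl hd σ

  one minus-one : Fin p
  one = fromℕₚ p 1
  minus-one = fromℕₚ p (p ∸ 1)

  1≉0 : ¬ (1 ≈ 0)
  1≉0 (≈i ())

  p∸1≉0 : ¬ (p ∸ 1 ≈ 0)
  p∸1≉0 h = 1≉0 (≈-trans (≈-sym (+-≈ h (≈-refl {1}))) (∸-inverse (s≤s z≤n)))

  bit : Bool → ℕ
  bit b = if b then 1 else 0

  valueEq lit : Fin m → Bool → Form m p
  valueEq e b = varEq e (bit b)
  lit e false = varEq e 1
  lit e true = varEq e 0

  clauseOf-∷ : ∀ e b ps → clauseOf ((e , b) ∷ ps) ≡ lit e b ∷ clauseOf ps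
  clauseOf-∷ e false ps = refl
  clauseOf-∷ e true ps = refl

  length-clauseOf : ∀ ps → length (clauseOf ps) ≡ length ps
  length-clauseOf = LP.length-map _

  boolean-presentation : ∀ e b → (varEq e 0 ∷ varEq e 1 ∷ []) ≋ (valueEq e b ∷ lit e b ∷ [])
  boolean-presentation e false = ClauseEquality.≋-refl
  boolean-presentation e true = ClauseEquality.∷-swap (varEq e 0) (varEq e 1) []

  coef : Fin n → Fin m → Fin p
  coef u e = _+ₚ_ p (if does (tl e ≟ᶠ u) then fromℕₚ p 1 else fromℕₚ p 0)
                    (if does (hd e ≟ᶠ u) then fromℕₚ p (p ∸ 1) else fromℕₚ p 0)

  coef≈ : ∀ u e → toℕ (coef u e) ≈ δ (tl e) u * 1 + δ (hd e) u * (p ∸ 1)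
  coef≈ u e = ≈-trans (toℕ-fromℕₚ≈ _)
    (+-≈ (≈-trans (toℕ-if _ 1) (≡⇒≈ (scaled (does (tl e ≟ᶠ u)) 1)))
         (≈-trans (toℕ-if _ (p ∸ 1)) (≡⇒≈ (scaled (does (hd e ≟ᶠ u)) (p ∸ 1)))))
    where
    scaled : ∀ b c → (if b then c else 0) ≡ (if b then 1 else 0) * c
    scaled true c = sym (+-identityʳ c)
    scaled false c = refl

  coef-from-δ : ∀ {u e x y} → δ (tl e) u ≡ x → δ (hd e) u ≡ y → toℕ (coef u e) ≈ x * 1 + y * (p ∸ 1)
  coef-from-δ {u} {e} refl refl = coef≈ u e

  coef-vanishes : ∀ u e → ¬ (tl e ≡ u ⊎ hd e ≡ u) → toℕ (coef u e) ≈ 0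
  coef-vanishes u e not-incident = coef-from-δ (δ-no (not-incident ∘ inj₁)) (δ-no (not-incident ∘ inj₂))

  -- the graph has no loops, so the coefficient of an incident edge is ±1 ≠ 0
  coef-nonzero : (∀ e → ¬ (tl e ≡ hd e)) → ∀ u e → (tl e ≡ u ⊎ hd e ≡ u) → ¬ (toℕ (coef u e) ≈ 0)
  coef-nonzero no-loop u e incident = cases (tl e ≟ᶠ u) (hd e ≟ᶠ u)
    where
    cases : Dec (tl e ≡ u) → Dec (hd e ≡ u) → ¬ (toℕ (coef u e) ≈ 0)
    cases (yes t) (yes h) _ = no-loop e (trans t (sym h))
    cases (yes t) (no ¬h) coef≈0 = 1≉0 (≈-trans (≈-sym (coef-from-δ (δ-yes t) (δ-no ¬h))) coef≈0)
    cases (no ¬t) (yes h) coef≈0 = p∸1≉0 (≈-trans (≈-sym (≈-trans (coef-from-δ (δ-no ¬t) (δ-yes h)) (≡⇒≈ (+-identityʳ (p ∸ 1))))) coef≈0)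
    cases (no ¬t) (no ¬h) _ = [ ¬t , ¬h ]′ incident

  flow-sem : ∀ u ps → toℕ (flow u ps) ≈ ∑ ps (λ x → bit (proj₂ x) * toℕ (coef u (proj₁ x)))
  flow-sem u [] = toℕ-fromℕₚ≈ 0
  flow-sem u ((e , false) ∷ ps) = flow-sem u ps
  flow-sem u ((e , true) ∷ ps) = begin
    toℕ (_+ₚ_ p (flow u ps) (coef u e))   ≈⟨ toℕ-fromℕₚ≈ _ ⟩
    toℕ (flow u ps) + c                    ≈⟨ +-≈ (flow-sem u ps) (≈-refl {c}) ⟩
    Σps + c                                ≡⟨ +-comm Σps c ⟩
    c + Σps                                ≡⟨ cong (_+ Σps) (+-identityʳ c) ⟨
    1 * c + Σps                            ∎
    where
    open SetoidReasoning ≈-setoid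
    c = toℕ (coef u e)
    Σps = ∑ ps (λ x → bit (proj₂ x) * toℕ (coef u (proj₁ x)))

  vertexEq : Fin n → Form m p
  vertexEq u = fromℕₚ p (p ∸ toℕ (σ u)) ∷ tabulate (coef u)

  vertexSem : Fin n → Fin (suc m) → ℕ
  vertexSem u fz = p ∸ toℕ (σ u)
  vertexSem u (fs j) = toℕ (coef u j)

  vertexEq-Rep : ∀ u → Rep (vertexEq u) (vertexSem u)
  vertexEq-Rep u fz = toℕ-fromℕₚ≈ _
  vertexEq-Rep u (fs j) = ≡⇒≈ (cong toℕ (VecP.lookup∘tabulate (coef u) j))

  incident-coef : ∀ u j → ∑ (inc u) (λ e → toℕ (coef u e) * δ e j) ≈ toℕ (coef u j)
  incident-coef u j = begin
    ∑ (inc u) (λ e → toℕ (coef u e) * δ e j)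
      ≈⟨ ∑-filter (λ e → (tl e ≟ᶠ u) ⊎-dec (hd e ≟ᶠ u)) (allFin m)
           (λ e not-incident → *-≈ (coef-vanishes u e not-incident) (≈-refl {δ e j})) ⟩
    ∑ (allFin m) (λ e → toℕ (coef u e) * δ e j)
      ≡⟨ ∑-cong (allFin m) (λ e → trans (*-comm _ (δ e j)) (cong (_* toℕ (coef u e)) (δ-sym e j))) ⟩
    ∑ (allFin m) (λ e → δ j e * toℕ (coef u e))
      ≡⟨ ∑-δ j (λ e → toℕ (coef u e)) ⟩
    toℕ (coef u j) ∎
    where open SetoidReasoning ≈-setoid

  -- k·(x_e − b) cancels against the contribution k·b of the value b of x_e
  value-cancel : ∀ k b → k * (p ∸ bit b) + bit b * k ≈ 0
  value-cancel k b = ≈-trans (≡⇒≈ (multiple b)) (≈-trans (*-≈ (≈-refl {k}) p≈0) (≡⇒≈ (*-zeroʳ k)))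
    where
    multiple : ∀ b → k * (p ∸ bit b) + bit b * k ≡ k * p
    multiple false = +-identityʳ (k * p)
    multiple true = begin
      k * suc q + (k + 0)   ≡⟨ cong (k * suc q +_) (+-identityʳ k) ⟩
      k * suc q + k         ≡⟨ +-comm (k * suc q) k ⟩
      k + k * suc q         ≡⟨ *-suc k (suc q) ⟨
      k * p                 ∎
      where open ≡-Reasoning

  -- For a satisfying assignment to the edges at u, the combination
  -- Σ_{(e,b)} coef(u,e)·(x_e − b) of boolean axioms is exactly L_u.
  satisfied-combo : ∀ u bits → length bits ≡ length (inc u) → flow u (zip (inc u) bits) ≡ σ u →
    ∀ {a as} → zip (inc u) bits ≡ a ∷ as →
    combo (λ x → coef u (proj₁ x)) (λ x → valueEq (proj₁ x) (proj₂ x)) a as ≡ vertexEq u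
  satisfied-combo u bits len sat {a} {as} ps≡ =
    Rep-ext (combo-Rep (λ x → coef u (proj₁ x)) (λ x → varEq-Rep (proj₁ x) (bit (proj₂ x))) a as)
            (vertexEq-Rep u)
            (λ i → subst (λ xs → term xs i ≈ vertexSem u i) ps≡ (same i))
    where
    ps = zip (inc u) bits
    term : List (Fin m × Bool) → Fin (suc m) → ℕ
    term xs i = ∑ xs (λ x → toℕ (coef u (proj₁ x)) * varEqSem (proj₁ x) (bit (proj₂ x)) i)
    flow≈σ : ∑ ps (λ x → bit (proj₂ x) * toℕ (coef u (proj₁ x))) ≈ toℕ (σ u)
    flow≈σ = ≈-trans (≈-sym (flow-sem u ps)) (≡⇒≈ (cong toℕ sat))
    constant-inverse : term ps fz + toℕ (σ u) ≈ 0
    constant-inverse = begin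
      term ps fz + toℕ (σ u)
        ≈⟨ +-≈ (≈-refl {term ps fz}) flow≈σ ⟨
      term ps fz + ∑ ps (λ x → bit (proj₂ x) * toℕ (coef u (proj₁ x)))
        ≡⟨ ∑-+ ps _ _ ⟩
      ∑ ps (λ x → toℕ (coef u (proj₁ x)) * (p ∸ bit (proj₂ x)) + bit (proj₂ x) * toℕ (coef u (proj₁ x)))
        ≈⟨ ∑-≈ ps (λ x → value-cancel (toℕ (coef u (proj₁ x))) (proj₂ x)) ⟩
      ∑ ps (λ _ → 0)
        ≡⟨ ∑-zero ps (λ _ → refl) ⟩
      0 ∎
      where open SetoidReasoning ≈-setoid
    same : ∀ i → term ps i ≈ vertexSem u i
    same fz = inverse-unique constant-inverse (∸-inverse (<⇒≤ (FinP.toℕ<n (σ u))))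
    same (fs j) = ≈-trans (≡⇒≈ (∑-zip (inc u) bits (λ e → toℕ (coef u e) * δ e j) len)) (incident-coef u j)

  -- every edge has coefficient 1 at its tail and −1 at its head, so these cancel in Σ_u L_u
  total-coef : ∀ j → ∑ (allFin n) (λ w → toℕ (coef w j)) ≈ 0
  total-coef j = begin
    ∑ (allFin n) (λ w → toℕ (coef w j))
      ≈⟨ ∑-≈ (allFin n) (λ w → coef≈ w j) ⟩
    ∑ (allFin n) (λ w → δ (tl j) w * 1 + δ (hd j) w * (p ∸ 1))
      ≡⟨ ∑-+ (allFin n) _ _ ⟨
    ∑ (allFin n) (λ w → δ (tl j) w * 1) + ∑ (allFin n) (λ w → δ (hd j) w * (p ∸ 1))
      ≡⟨ cong₂ _+_ (∑-δ (tl j) (λ _ → 1)) (∑-δ (hd j) (λ _ → p ∸ 1)) ⟩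
    1 + (p ∸ 1)
      ≡⟨ +-comm 1 (p ∸ 1) ⟩
    p ∸ 1 + 1
      ≈⟨ ∸-inverse (s≤s z≤n) ⟩
    0 ∎
    where open SetoidReasoning ≈-setoid

  total-constant : ¬ (p ∣ sum (map (λ u → toℕ (σ u)) (allFin n))) →
    ¬ (∑ (allFin n) (λ w → p ∸ toℕ (σ w)) ≈ 0)
  total-constant p∤Σσ minus≈0 = p∤Σσ (m%n≡0⇒n∣m _ p (trans (un Σσ≈0) 0%p≡0))
    where
    inverses : ∑ (allFin n) (λ w → p ∸ toℕ (σ w)) + ∑ (allFin n) (λ w → toℕ (σ w)) ≈ 0
    inverses = ≈-trans (≡⇒≈ (∑-+ (allFin n) _ _))
      (≈-trans (∑-≈ (allFin n) (λ w → ∸-inverse (<⇒≤ (FinP.toℕ<n (σ w))))) (≡⇒≈ (∑-zero (allFin n) (λ _ → refl))))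
    Σσ≈0 : ∑ (allFin n) (λ w → toℕ (σ w)) ≈ 0
    Σσ≈0 = ≈-trans (≈-sym (+-≈ minus≈0 (≈-refl {∑ (allFin n) (λ w → toℕ (σ w))}))) inverses

  sum-nonzero : ¬ (p ∣ sum (map (λ u → toℕ (σ u)) (allFin n))) →
    ∀ {u us} → allFin n ≡ u ∷ us → NonzeroConst (combo (λ _ → one) vertexEq u us)
  sum-nonzero p∤Σσ {u} {us} vertices = nonzero-Rep {f = combo (λ _ → one) vertexEq u us}
    (Rep-cong {f = combo (λ _ → one) vertexEq u us}
      (subst (λ xs → Rep (combo (λ _ → one) vertexEq u us) (λ i → ∑ xs (λ w → toℕ one * vertexSem w i)))
             (sym vertices) (combo-Rep (λ _ → one) vertexEq-Rep u us))
      (λ i → ∑-≈ (allFin n) (λ w → one-* (vertexSem w i))))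
    (total-constant p∤Σσ) total-coef

  falsified∈F : ∀ u bits → length bits ≡ length (inc u) → ¬ (flow u (zip (inc u) bits) ≡ σ u) →
    clauseOf (zip (inc u) bits) ∈ F
  falsified∈F u bits len violated = ∈-concat⁺′
    (∈-map⁺ clauseOf (∈-filter⁺ (λ α → ¬? (flow u α ≟ᶠ σ u)) (∈-map⁺ (zip (inc u)) bits∈) violated))
    (∈-map⁺ (vertexCNF p tl hd σ) (∈-allFin u))
    where
    bits∈ : bits ∈ assignments (length (inc u))
    bits∈ = subst (λ k → bits ∈ assignments k) len (assignments-complete bits)

  -- resolving  x_e = 1  against  x_e = 0  with coefficients 1 and −1 leaves the constant −1
  pivot-nonzero : (e : Fin m) → NonzeroConst (lincomb one minus-one (varEq e 1) (varEq e 0))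
  pivot-nonzero e = nonzero-Rep {f = lincomb one minus-one (varEq e 1) (varEq e 0)}
    (lincomb-Rep one minus-one {varEq e 1} {varEq e 0} (varEq-Rep e 1) (varEq-Rep e 0)) constant vanishing
    where
    constant : ¬ (toℕ one * (p ∸ 1) + toℕ minus-one * p ≈ 0)
    constant c≈0 = p∸1≉0 (≈-trans (≈-sym c≈p∸1) c≈0)
      where
      c≈p∸1 : toℕ one * (p ∸ 1) + toℕ minus-one * p ≈ p ∸ 1
      c≈p∸1 = ≈-trans (+-≈ (one-* (p ∸ 1)) (≈-trans (*-≈ (≈-refl {toℕ minus-one}) p≈0) (≡⇒≈ (*-zeroʳ (toℕ minus-one)))))
                      (≡⇒≈ (+-identityʳ (p ∸ 1)))
    vanishing : ∀ j → toℕ one * δ e j + toℕ minus-one * δ e j ≈ 0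
    vanishing j = begin
      toℕ one * δ e j + toℕ minus-one * δ e j
        ≈⟨ +-≈ (*-≈ (toℕ-fromℕₚ≈ 1) (≈-refl {δ e j})) (*-≈ (toℕ-fromℕₚ≈ (p ∸ 1)) (≈-refl {δ e j})) ⟩
      1 * δ e j + (p ∸ 1) * δ e j               ≡⟨ *-distribʳ-+ (δ e j) 1 (p ∸ 1) ⟨
      p * δ e j                                 ≈⟨ *-≈ p≈0 (≈-refl {δ e j}) ⟩
      0 ∎
      where open SetoidReasoning ≈-setoid

  isolated-violated : IsRegular tl hd 0 → ∀ u → ¬ (toℕ (σ u) ≡ 0) → [] ∈ F
  isolated-violated regular u σu≢0 =
    subst (_∈ F) (cong clauseOf no-edges) (falsified∈F u [] (sym (regular u)) violated)
    where
    no-edges : zip (inc u) [] ≡ []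
    no-edges = LP.zipWith-zeroʳ _,_ (inc u)
    violated : ¬ (flow u (zip (inc u) []) ≡ σ u)
    violated sat = σu≢0 (sym (cong toℕ (trans (sym (cong (flow u) no-edges)) sat)))

-- Node counts of a complete binary splitting tree of depth k whose leaves
-- are derived with N nodes each (every split costs a resolution and a
-- simplification).
splitCost : ℕ → ℕ → ℕ
splitCost N zero = N
splitCost N (suc k) = 2 + (splitCost N k + splitCost N k)

splitCost-closed : ∀ N k → splitCost N k + 2 ≡ 2 ^ k * (N + 2)
splitCost-closed N zero = sym (*-identityˡ (N + 2))
splitCost-closed N (suc k) = begin
  2 + (T + T) + 2      ≡⟨ doubling T ⟩
  2 * (T + 2)          ≡⟨ cong (2 *_) (splitCost-closed N k) ⟩
  2 * (2 ^ k * (N + 2)) ≡⟨ *-assoc 2 (2 ^ k) (N + 2) ⟨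
  2 ^ suc k * (N + 2)  ∎
  where
  open ≡-Reasoning
  T = splitCost N k
  doubling : ∀ T → 2 + (T + T) + 2 ≡ 2 * (T + 2)
  doubling = solve-∀

module TseitinRefutation {n m : ℕ} (tl hd : Fin m → Fin n) (q : ℕ) (σ : Fin n → Fin (suc (suc q)))
                         (d′ : ℕ) (regular : IsRegular tl hd (suc d′)) where
  open Tseitin tl hd q σ
  open Congruence p using (combo)
  open ClauseEquality

  d : ℕ
  d = suc d′

  -- every clause of the refutation has at most d + 2 formulas
  open BoundedDerivations F (2 + d) public

  length-assignment : ∀ u (bits : List Bool) → length bits ≡ length (inc u) → length (zip (inc u) bits) ≡ d
  length-assignment u bits len = trans (length-zip (inc u) bits len) (regular u)

  leafCost : ℕ
  leafCost = (1 + d) * 2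

  booleanᵇ : ∀ x → Derivable (valueEq (proj₁ x) (proj₂ x) ∷ lit (proj₁ x) (proj₂ x) ∷ []) 1
  booleanᵇ (e , b) = Derivable-≋ (boolean-presentation e b) (booleanᴰ e)

  literals : List (Fin m × Bool) → Clause m p
  literals = concatMap (λ x → lit (proj₁ x) (proj₂ x) ∷ [])

  literals≡clauseOf : ∀ ps → literals ps ≡ clauseOf ps
  literals≡clauseOf [] = refl
  literals≡clauseOf ((e , b) ∷ ps) = trans (cong (lit e b ∷_) (literals≡clauseOf ps)) (sym (clauseOf-∷ e b ps))

  length-literals : ∀ ps → length (literals ps) ≡ length ps
  length-literals ps = trans (cong length (literals≡clauseOf ps)) (length-clauseOf ps)

  satisfied-leaf : ∀ u bits → length bits ≡ length (inc u) → flow u (zip (inc u) bits) ≡ σ u →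
    Derivable (clauseOf (zip (inc u) bits) ++ vertexEq u ∷ []) leafCost
  satisfied-leaf u bits len sat = chain (zip (inc u) bits) refl (length-assignment u bits len)
    where
    chain : ∀ ps → zip (inc u) bits ≡ ps → length ps ≡ d → Derivable (clauseOf ps ++ vertexEq u ∷ []) leafCost
    chain (a ∷ as) ps≡ len-ps =
      Derivable-mono (≤-reflexive (cong (λ k → (2 + k) * 2) (suc-injective len-ps)))
        (Derivable-≋ (≋-trans (≡⇒≋ (cong₂ _∷_ (satisfied-combo u bits len sat ps≡) (literals≡clauseOf (a ∷ as))))
                              (∷-snoc (vertexEq u) (clauseOf (a ∷ as))))
          (combine (λ x → coef u (proj₁ x)) (λ x → valueEq (proj₁ x) (proj₂ x)) (λ x → lit (proj₁ x) (proj₂ x) ∷ [])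
                   booleanᵇ a as (s≤s (s≤s (≤-trans (≤-reflexive (trans (length-literals as) (suc-injective len-ps))) (n≤1+n d′))))))

  violated-leaf : ∀ u bits → length bits ≡ length (inc u) → ¬ (flow u (zip (inc u) bits) ≡ σ u) →
    Derivable (clauseOf (zip (inc u) bits) ++ vertexEq u ∷ []) leafCost
  violated-leaf u bits len violated =
    Derivable-mono (s≤s (s≤s z≤n))
      (Derivable-≋ (∷-snoc (vertexEq u) (clauseOf (zip (inc u) bits)))
        (weakeningᴰ (axiomᴰ (falsified∈F u bits len violated))
          (≤-trans (≤-reflexive (trans (length-clauseOf (zip (inc u) bits)) (length-assignment u bits len))) (≤-trans (n≤1+n d) (n≤1+n (1 + d))))))

  leaf : ∀ u bits → length bits ≡ length (inc u) → Derivable (clauseOf (zip (inc u) bits) ++ vertexEq u ∷ []) leafCost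
  leaf u bits len with flow u (zip (inc u) bits) ≟ᶠ σ u
  ... | yes sat = satisfied-leaf u bits len sat
  ... | no violated = violated-leaf u bits len violated

  -- A split on x_e
  -- resolves  x_e = 1 ∨ Γ  with  x_e = 0 ∨ Γ  (coefficients 1, −1) and
  -- simplifies the resulting constant −1 away.
  splitOn : ∀ {N} (es : List (Fin m)) (Γ : Clause m p) → length Γ + length es ≤ suc d →
    (∀ bits → length bits ≡ length es → Derivable (clauseOf (zip es bits) ++ Γ) N) →
    Derivable Γ (splitCost N (length es))
  splitOn [] Γ _ leaves = leaves [] refl
  splitOn {N} (e ∷ es) Γ len leaves =
    simplificationᴰ (pivot-nonzero e)
      (Derivable-≋ (∷-cong _ (++-idem Γ)) (resolutionᴰ one minus-one (branch false) (branch true) short short))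
      short
    where
    short : suc (length Γ) ≤ 2 + d
    short = ≤-trans (s≤s (m≤m+n (length Γ) (length es)))
              (≤-trans (≤-reflexive (sym (+-suc (length Γ) (length es)))) (≤-trans len (n≤1+n (suc d))))
    branch : ∀ b → Derivable (lit e b ∷ Γ) (splitCost N (length es))
    branch b = splitOn es (lit e b ∷ Γ) (≤-trans (≤-reflexive (sym (+-suc (length Γ) (length es)))) len)
      λ bits l → Derivable-≋ (≋-trans (≡⇒≋ (cong (_++ Γ) (clauseOf-∷ e b (zip es bits)))) (∷-++ (lit e b) _ Γ))
                             (leaves (b ∷ bits) (cong suc l))

  vertexCost : ℕ
  vertexCost = splitCost leafCost d

  vertexᴰ : ∀ u → Derivable (vertexEq u ∷ []) vertexCost
  vertexᴰ u = subst (λ k → Derivable (vertexEq u ∷ []) (splitCost leafCost k)) (regular u)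
    (splitOn (inc u) (vertexEq u ∷ []) (≤-reflexive (cong suc (regular u))) (leaf u))

  refutation : ¬ (p ∣ sum (map (λ u → toℕ (σ u)) (allFin n))) → ∀ {u us} → allFin n ≡ u ∷ us →
    Σ (Refutation F) (λ π → derivSize π ≤ (1 + (1 + n) * suc vertexCost) * S)
  refutation p∤Σσ {u} {us} vertices = subst (λ k → Σ (Refutation F) (λ π → derivSize π ≤ (1 + k * suc vertexCost) * S))
    (cong suc size)
    (refutationᴰ (simplificationᴰ (sum-nonzero p∤Σσ vertices)
      (Derivable-≋ (≡⇒≋ (cong (combo (λ _ → one) vertexEq u us ∷_) (concatMap-[] (u ∷ us))))
        (combine (λ _ → one) vertexEq (λ _ → []) vertexᴰ u us
          (≤-trans (≤-reflexive (cong (suc ∘ length) (concatMap-[] (u ∷ us)))) (s≤s z≤n))))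
      (s≤s z≤n)))
    where
    size : suc (length us) ≡ n
    size = trans (cong length (sym vertices)) (LP.length-tabulate (λ x → x))

module TseitinSize {n m : ℕ} (tl hd : Fin m → Fin n) (q : ℕ) (σ : Fin n → Fin (suc (suc q)))
                   (digraph : IsDigraph tl hd) (d′ : ℕ) (regular : IsRegular tl hd (suc d′)) where
  open Tseitin tl hd q σ
  open Congruence p

  incident-∷ : ∀ u → Σ (Fin m) λ e → Σ (List (Fin m)) λ I → inc u ≡ e ∷ I
  incident-∷ u with inc u | regular u
  ... | e ∷ I | _ = e , I , refl

  violates? : (u : Fin n) → Decidable (λ α → ¬ (flow u α ≡ σ u))
  violates? u α = ¬? (flow u α ≟ᶠ σ u)

  violatedSize : Fin n → List (List (Fin m × Bool)) → ℕ
  violatedSize u αs = cnfSize (map clauseOf (filter (violates? u) αs))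

  violatedSize-∷ : ∀ u α αs → violatedSize u αs ≤ violatedSize u (α ∷ αs)
  violatedSize-∷ u α αs with flow u α ≟ᶠ σ u
  ... | yes _ = ≤-refl
  ... | no _ = m≤n+m _ _

  violatedSize-gain : ∀ u α αs → ¬ (flow u α ≡ σ u) → 1 ≤ clauseSize (clauseOf α) →
    suc (violatedSize u αs) ≤ violatedSize u (α ∷ αs)
  violatedSize-gain u α αs violated size rewrite LP.filter-accept (violates? u) {α} {αs} violated =
    +-monoˡ-≤ (violatedSize u αs) size

  varEq-size : (e : Fin m) (c : ℕ) → 1 ≤ formSize (varEq {m} {p} e c)
  varEq-size e c = ≤-trans entry
    (≤-trans (∈-∑ entrySize (VecMem.∈-toList⁺ (VecMem.∈-lookup e v))) (m≤n+m _ (coeffSize (fromℕₚ p (p ∸ c)))))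
    where
    v : Vec (Fin p) m
    v = tabulate (λ j → if does (e ≟ᶠ j) then fromℕₚ p 1 else fromℕₚ p 0)
    entry : 1 ≤ entrySize (lookup v e)
    entry rewrite VecP.lookup∘tabulate (λ j → if does (e ≟ᶠ j) then fromℕₚ p 1 else fromℕₚ p 0) e with e ≟ᶠ e
    ... | yes _ = s≤s z≤n
    ... | no e≢e = ⊥-elim (e≢e refl)

  lit-size : ∀ {e} b → 1 ≤ formSize (lit e b)
  lit-size {e} false = varEq-size e 1
  lit-size {e} true = varEq-size e 0

  clauseOf-size : ∀ e b ps → 1 ≤ clauseSize (clauseOf ((e , b) ∷ ps))
  clauseOf-size e b ps = ≤-trans (lit-size b) (clauseSize-≥ (subst (lit e b ∈_) (sym (clauseOf-∷ e b ps)) (here refl)))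

  flip-violates : ∀ {u e} ps → e ∈ inc u → flow u ((e , false) ∷ ps) ≡ σ u → ¬ (flow u ((e , true) ∷ ps) ≡ σ u)
  flip-violates {u} {e} ps e∈ sat₀ sat₁ = coef-nonzero (proj₁ digraph) u e at-u
    (+ₚ-cancel (flow u ps) (coef u e) (trans sat₁ (sym sat₀)))
    where
    at-u = proj₂ (∈-filter⁻ (λ e → (tl e ≟ᶠ u) ⊎-dec (hd e ≟ᶠ u)) {xs = allFin m} e∈)

  -- of each pair of assignments differing only at e, at least one violates the constraint at u
  pairs-bound : ∀ {u e} (I : List (Fin m)) → e ∈ inc u → (A : List (List Bool)) →
    length A ≤ violatedSize u (map (zip (e ∷ I)) (concatMap (λ a → (false ∷ a) ∷ (true ∷ a) ∷ []) A))
  pairs-bound I e∈ [] = z≤n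
  pairs-bound {u} {e} I e∈ (a ∷ A) = split (flow u α₀ ≟ᶠ σ u)
    where
    α₀ α₁ : List (Fin m × Bool)
    α₀ = (e , false) ∷ zip I a
    α₁ = (e , true) ∷ zip I a
    rest = map (zip (e ∷ I)) (concatMap (λ a → (false ∷ a) ∷ (true ∷ a) ∷ []) A)
    split : Dec (flow u α₀ ≡ σ u) → suc (length A) ≤ violatedSize u (α₀ ∷ α₁ ∷ rest)
    split (no violated₀) =
      ≤-trans (s≤s (≤-trans (pairs-bound I e∈ A) (violatedSize-∷ u α₁ rest)))
              (violatedSize-gain u α₀ (α₁ ∷ rest) violated₀ (clauseOf-size e false (zip I a)))
    split (yes sat₀) =
      ≤-trans (≤-trans (s≤s (pairs-bound I e∈ A))
                       (violatedSize-gain u α₁ rest (flip-violates (zip I a) e∈ sat₀) (clauseOf-size e true (zip I a))))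
              (violatedSize-∷ u α₀ (α₁ ∷ rest))

  -- half of the 2^d assignments at a vertex are violating
  vertex-size : ∀ u → 2 ^ d′ ≤ cnfSize (vertexCNF p tl hd σ u)
  vertex-size u with incident-∷ u
  ... | e , I , eq = subst (λ es → 2 ^ d′ ≤ violatedSize u (map (zip es) (assignments (length es)))) (sym eq)
    (≤-trans (≤-reflexive (trans (cong (2 ^_) (sym |I|≡d′)) (sym (length-assignments (length I)))))
             (pairs-bound I (subst (e ∈_) (sym eq) (here refl)) (assignments (length I))))
    where
    |I|≡d′ : length I ≡ d′
    |I|≡d′ = suc-injective (trans (sym (cong length eq)) (regular u))

  formula-size : n * 2 ^ d′ ≤ cnfSize F
  formula-size = begin
    n * 2 ^ d′                                  ≡⟨ cong (_* 2 ^ d′) (LP.length-tabulate {n = n} (λ x → x)) ⟨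
    length (allFin n) * 2 ^ d′                   ≤⟨ ∑-≥ (allFin n) vertex-size ⟩
    ∑ (allFin n) (λ u → cnfSize (vertexCNF p tl hd σ u)) ≡⟨ cnfSize-concatMap (vertexCNF p tl hd σ) (allFin n) ⟨
    cnfSize F                                   ∎
    where open ≤-Reasoning

  -- a vertex with nonzero charge is violated by the all-false assignment,
  -- whose clause contains  x_e = 1  with constant term p − 1
  coeff-size : ∀ u → ¬ (toℕ (σ u) ≡ 0) → ⌈log₂ p ⌉ ≤ cnfSize F
  coeff-size u σu≢0 with incident-∷ u
  ... | e , I , eq = ≤-trans (≤-reflexive (sym constant-size))
    (≤-trans (m≤m+n _ _) (≤-trans (clauseSize-≥ {f = varEq e 1} x≡1∈) (cnfSize-≥ (falsified∈F u zeros (LP.length-replicate _) violated))))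
    where
    zeros = replicate (length (inc u)) false
    all-false : ∀ L → flow u (zip L (replicate (length L) false)) ≡ fromℕₚ p 0
    all-false [] = refl
    all-false (x ∷ L) = all-false L
    violated : ¬ (flow u (zip (inc u) zeros) ≡ σ u)
    violated sat = σu≢0 (sym (cong toℕ (trans (sym (all-false (inc u))) sat)))
    x≡1∈ : varEq e 1 ∈ clauseOf (zip (inc u) zeros)
    x≡1∈ = subst (λ L → varEq e 1 ∈ clauseOf (zip L (replicate (length L) false))) (sym eq) (here refl)
    constant-size : coeffSize (fromℕₚ p (p ∸ 1)) ≡ ⌈log₂ p ⌉
    constant-size = cong (λ k → ⌈log₂ suc k ⌉) (trans (FinP.toℕ-fromℕ< _) (m<n⇒m%n≡m (n<1+n (suc q))))

  -- no two edges have the same endpoints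
  edges-size : m ≤ n * n
  edges-size = FinP.injective⇒≤ {f = λ e → Data.Fin.combine (tl e) (hd e)} injective
    where
    injective : ∀ {e e′} → Data.Fin.combine (tl e) (hd e) ≡ Data.Fin.combine (tl e′) (hd e′) → e ≡ e′
    injective {e} {e′} h with FinP.combine-injective (tl e) (hd e) (tl e′) (hd e′) h
    ... | tl≡ , hd≡ = proj₂ digraph e e′ tl≡ hd≡

charged-vertex : ∀ {n p} (σ : Fin n → Fin p) → ¬ (p ∣ sum (map (λ u → toℕ (σ u)) (allFin n))) →
  Σ (Fin n) λ u → ¬ (toℕ (σ u) ≡ 0)
charged-vertex {p = p} σ p∤Σσ = nonzero-summand (allFin _) (λ u → toℕ (σ u)) (λ Σσ≡0 → p∤Σσ (subst (p ∣_) (sym Σσ≡0) (p ∣0)))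

2^-positive : ∀ k → 1 ≤ 2 ^ k
2^-positive zero = s≤s z≤n
2^-positive (suc k) = ≤-trans (2^-positive k) (m≤m+n (2 ^ k) _)

suc≤2^ : ∀ k → suc k ≤ 2 ^ k
suc≤2^ zero = s≤s z≤n
suc≤2^ (suc k) = +-mono-≤ (2^-positive k) (≤-trans (suc≤2^ k) (≤-reflexive (sym (+-identityʳ (2 ^ k)))))

-- The final estimate, as arithmetic: the node count is at most 8·(n·2^d′)·(3 + d′),
-- a clause has size at most (3 + d′)(1 + m)(1 + B), and n·2^d′, d′, B ≤ Z, m ≤ n².
size-estimate : ∀ {n d′ m B Z} → 1 ≤ n → n * 2 ^ d′ ≤ Z → m ≤ n * n → B ≤ Z →
  (1 + (1 + n) * suc (splitCost ((2 + d′) * 2) (suc d′))) * ((3 + d′) * (suc m * suc B)) ≤ 288 * Z ^ 6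
size-estimate {n} {d′} {m} {B} {Z} 1≤n T≤Z m≤n² B≤Z = begin
  (1 + (1 + n) * suc V) * S                                  ≤⟨ *-mono-≤ nodes clause ⟩
  8 * Z * (Z + Z + Z) * ((Z + Z + Z) * ((Z * Z + Z * Z) * (Z + Z))) ≡⟨ sixth-power Z ⟩
  288 * Z ^ 6                                                ∎
  where
  open ≤-Reasoning
  V = splitCost ((2 + d′) * 2) (suc d′)
  S = (3 + d′) * (suc m * suc B)
  n≤Z : n ≤ Z
  n≤Z = ≤-trans (≤-trans (≤-reflexive (sym (*-identityʳ n))) (*-monoʳ-≤ n (2^-positive d′))) T≤Z
  1≤Z : 1 ≤ Z
  1≤Z = ≤-trans 1≤n n≤Z
  3+d′≤3Z : 3 + d′ ≤ Z + Z + Z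
  3+d′≤3Z = ≤-trans (≤-reflexive (trans (+-comm 2 (suc d′)) (sym (+-assoc (suc d′) 1 1)))) (+-mono-≤ (+-mono-≤ suc-d′≤Z 1≤Z) 1≤Z)
    where
    suc-d′≤Z : suc d′ ≤ Z
    suc-d′≤Z = ≤-trans (suc≤2^ d′) (≤-trans (≤-trans (≤-reflexive (sym (*-identityˡ (2 ^ d′)))) (*-monoˡ-≤ (2 ^ d′) 1≤n)) T≤Z)
  doubling : ∀ n t d′ → (n + n) * (2 * t * ((2 + d′) * 2 + 2)) ≡ 8 * (n * t) * (3 + d′)
  doubling = solve-∀
  sixth-power : ∀ Z → 8 * Z * (Z + Z + Z) * ((Z + Z + Z) * ((Z * Z + Z * Z) * (Z + Z))) ≡
                      288 * (Z * (Z * (Z * (Z * (Z * (Z * 1))))))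
  sixth-power = solve-∀
  nodes : 1 + (1 + n) * suc V ≤ 8 * Z * (Z + Z + Z)
  nodes = begin
    1 + (1 + n) * suc V          ≤⟨ +-monoˡ-≤ ((1 + n) * suc V) (s≤s z≤n) ⟩
    (1 + n) + (1 + n) * suc V    ≡⟨ *-suc (1 + n) (suc V) ⟨
    (1 + n) * (2 + V)            ≡⟨ cong ((1 + n) *_) (+-comm 2 V) ⟩
    (1 + n) * (V + 2)            ≤⟨ *-monoˡ-≤ (V + 2) (+-monoˡ-≤ n 1≤n) ⟩
    (n + n) * (V + 2)            ≡⟨ cong ((n + n) *_) (splitCost-closed ((2 + d′) * 2) (suc d′)) ⟩
    (n + n) * (2 * 2 ^ d′ * ((2 + d′) * 2 + 2)) ≡⟨ doubling n (2 ^ d′) d′ ⟩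
    8 * (n * 2 ^ d′) * (3 + d′)  ≤⟨ *-mono-≤ (*-monoʳ-≤ 8 T≤Z) 3+d′≤3Z ⟩
    8 * Z * (Z + Z + Z)          ∎
  clause : S ≤ (Z + Z + Z) * ((Z * Z + Z * Z) * (Z + Z))
  clause = *-mono-≤ 3+d′≤3Z (*-mono-≤ (+-mono-≤ (*-mono-≤ 1≤Z 1≤Z) (≤-trans m≤n² (*-mono-≤ n≤Z n≤Z))) (+-mono-≤ 1≤Z B≤Z))

mainTheorem20 : ∃[ c ] ∃[ k ]
    ∀ (n m : ℕ) (tl hd : Fin m → Fin n) (d p : ℕ) .{{_ : NonZero p}} →
      Prime p → IsDigraph tl hd → IsRegular tl hd d →
      (σ : Fin n → Fin p) → ¬ (p ∣ sum (map (λ u → toℕ (σ u)) (allFin n))) →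
      Σ (Refutation (TseitinCNF p tl hd σ)) λ π →
        derivSize π ≤ c * cnfSize (TseitinCNF p tl hd σ) ^ k + c
mainTheorem20 = 288 , 6 , refute
  where
  refute : ∀ (n m : ℕ) (tl hd : Fin m → Fin n) (d p : ℕ) .{{_ : NonZero p}} →
    Prime p → IsDigraph tl hd → IsRegular tl hd d →
    (σ : Fin n → Fin p) → ¬ (p ∣ sum (map (λ u → toℕ (σ u)) (allFin n))) →
    Σ (Refutation (TseitinCNF p tl hd σ)) λ π → derivSize π ≤ 288 * cnfSize (TseitinCNF p tl hd σ) ^ 6 + 288
  refute n m tl hd d 0 p-prime = ⊥-elim (¬prime[0] p-prime)
  refute n m tl hd d 1 p-prime = ⊥-elim (¬prime[1] p-prime)
  -- d = 0: the charged vertex is isolated and its constraint is the empty clause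
  refute n m tl hd 0 (suc (suc q)) _ _ regular σ p∤Σσ =
    axiom (Tseitin.isolated-violated tl hd q σ regular u σu≢0) ClauseEquality.≋-refl , z≤n
    where
    charged = charged-vertex σ p∤Σσ
    u = proj₁ charged
    σu≢0 = proj₂ charged
  refute n m tl hd (suc d′) (suc (suc q)) _ digraph regular σ p∤Σσ =
    proj₁ π , ≤-trans (proj₂ π) (≤-trans (size-estimate {d′ = d′} 1≤n formula-size edges-size (coeff-size u σu≢0)) (m≤m+n _ 288))
    where
    open TseitinSize tl hd q σ digraph d′ regular
    charged = charged-vertex σ p∤Σσ
    u = proj₁ charged
    σu≢0 = proj₂ charged
    1≤n : 1 ≤ n
    1≤n = ≤-trans (s≤s z≤n) (FinP.toℕ<n u)
    π = TseitinRefutation.refutation tl hd q σ d′ regular p∤Σσ (proj₂ (proj₂ (allFin-∷ u)))
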